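{- In the canonical hypergraph model of $\mathsf{2CH}$, for every agent $a$, every maximal consistent set $S_E$ of world formulas and every maximal consistent set $S_a$ of formulas of sort $a$ with $S_E\,R_a\,S_a$, and every world formula $\Phi$: if $\Box_a\Phi\in S_a$ then $\Phi\in S_E$.
   Context: Syntax. Fix a finite set $\mathcal{A}$ of agents, sets $AP_a$ ($a\in\mathcal A$) and $AP_e$ of atomic propositions. Agent formulas of sort $a$: $\varphi ::= p_a \mid \neg\varphi \mid \varphi\wedge\psi \mid \Diamond_a\Phi$ ($p_a\in AP_a$, $\Phi$ a world formula). World formulas: $\Phi ::= p_e \mid \neg\Phi \mid \Phi\wedge\Psi \mid \langle a\rangle\varphi$ ($p_e\in AP_e$, $\varphi$ of sort $a$). Abbreviations: usual $\top,\bot,\vee,\to$; $\Box_a\Phi:=\neg\Diamond_a\neg\Phi$; $[a]\varphi:=\neg\langle a\rangle\neg\varphi$. Proof system. $\vdash_a$, $\vdash_e$ are the least relations containing all propositional tautology instances at each sort, closed under modus ponens at each sort, and under: from $\vdash_e\Phi$ infer $\vdash_a\Box_a\Phi$; from $\vdash_a\varphi$ infer $\vdash_e[a]\varphi$; from $\vdash_e\Phi\to\Psi$ infer $\vdash_a\Diamond_a\Phi\to\Diamond_a\Psi$ and $\vdash_a\Box_a\Phi\to\Box_a\Psi$; from $\vdash_a\varphi\to\psi$ infer $\vdash_e\langle a\rangle\varphi\to\langle a\rangle\psi$ and $\vdash_e[a]\varphi\to[a]\psi$; $\vdash_e\Phi\to[a]\psi$ iff $\vdash_a\Diamond_a\Phi\to\psi$;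 $\vdash_a\varphi\to\Box_a\Psi$ iff $\vdash_e\langle a\rangle\varphi\to\Psi$; axioms $\vdash_a\varphi\to\Diamond_a\langle a\rangle\varphi$, $\vdash_a\Diamond_a\langle a\rangle\varphi\to\varphi$, $\vdash_e\bigvee_{a\in\mathcal A}\langle a\rangle\top$. A set of formulas of a given sort is inconsistent if $\bot$ is derivable from it (using the derivable formulas of that sort and modus ponens), consistent otherwise, and maximal consistent (MCS) if it is consistent and not a proper subset of a consistent set of that sort. Canonical model: $E$ is the set of MCS of world formulas; $V_a$ is the set of MCS of sort-$a$ formulas; $R_a\subseteq E\times V_a$ is defined by $S_E\,R_a\,S_a$ iff for all world formulas $\Phi$, $\Phi\in S_E$ implies $\Diamond_a\Phi\in S_a$; valuations $\ell_\ast(p_\ast)=\{S_\ast \mid p_\ast\in S_\ast\}$. -}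

module Defs where

open import Data.Nat using (ℕ)
open import Data.Bool using (Bool; true; false; not; _∧_)
open import Data.Fin using (Fin)
open import Data.List using (List; foldr; map)
open import Data.List.Base using (allFin)
open import Data.Empty using (⊥)
open import Relation.Binary.PropositionalEquality using (_≡_)
open import Relation.Nullary using (¬_)
open import Relation.Unary using (Pred; _∈_; _⊆_)
open import Level using (0ℓ)
open import Data.Product using (Σ; _×_; _,_)

-- Classical propositional formulas over variables ℕ (for "tautology
-- instances").  Primitive connectives: ⊥, ¬, ∧.

data PForm : Set where
  pvar : ℕ → PForm
  p⊥   : PForm
  p¬   : PForm → PForm
  p∧   : PForm → PForm → PForm

eval : (ℕ → Bool) → PForm → Bool
eval v (pvar i)  = v i
eval v p⊥        = false
eval v (p¬ t)    = not (eval v t)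
eval v (p∧ t u)  = eval v t ∧ eval v u

Tautology : PForm → Set
Tautology t = ∀ (v : ℕ → Bool) → eval v t ≡ true

module TwoCH (n : ℕ) (APa : Fin n → Set) (APe : Set) where

  Agent : Set
  Agent = Fin n

  data Sort : Set where
    ag : Agent → Sort
    wo : Sort

  infixr 6 _∧'_
  data Form : Sort → Set where
    atomA : ∀ {a} → APa a → Form (ag a)
    atomE : APe → Form wo
    ⊥'    : ∀ {s} → Form s
    ¬'    : ∀ {s} → Form s → Form s
    _∧'_  : ∀ {s} → Form s → Form s → Form s
    ◇     : (a : Agent) → Form wo → Form (ag a)
    ⟨_⟩   : (a : Agent) → Form (ag a) → Form wo

  ⊤' : ∀ {s} → Form s
  ⊤' = ¬' ⊥'

  infixr 4 _⇒_
  _⇒_ : ∀ {s} → Form s → Form s → Form s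
  φ ⇒ ψ = ¬' (φ ∧' ¬' ψ)

  infixr 5 _∨'_
  _∨'_ : ∀ {s} → Form s → Form s → Form s
  φ ∨' ψ = ¬' (¬' φ ∧' ¬' ψ)

  □ : (a : Agent) → Form wo → Form (ag a)
  □ a Φ = ¬' (◇ a (¬' Φ))

  [_] : (a : Agent) → Form (ag a) → Form wo
  [ a ] φ = ¬' (⟨ a ⟩ (¬' φ))

  ⋁ : ∀ {s} → List (Form s) → Form s
  ⋁ = foldr _∨'_ ⊥'

  inst : ∀ {s} → (ℕ → Form s) → PForm → Form s
  inst σ (pvar i)  = σ i
  inst σ p⊥        = ⊥'
  inst σ (p¬ t)    = ¬' (inst σ t)
  inst σ (p∧ t u)  = inst σ t ∧' inst σ u

  -- the proof system ⊢ (⊢_a for sort ag a, ⊢_e for sort wo)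
  data ⊢_ : ∀ {s} → Form s → Set where
    taut   : ∀ {s} (t : PForm) → Tautology t → (σ : ℕ → Form s) → ⊢ inst σ t
    mp     : ∀ {s} {φ ψ : Form s} → ⊢ φ → ⊢ (φ ⇒ ψ) → ⊢ ψ
    nec□   : ∀ {a} {Φ : Form wo} → ⊢ Φ → ⊢ □ a Φ
    nec[]  : ∀ {a} {φ : Form (ag a)} → ⊢ φ → ⊢ [ a ] φ
    mono◇  : ∀ {a} {Φ Ψ : Form wo} → ⊢ (Φ ⇒ Ψ) → ⊢ (◇ a Φ ⇒ ◇ a Ψ)
    mono□  : ∀ {a} {Φ Ψ : Form wo} → ⊢ (Φ ⇒ Ψ) → ⊢ (□ a Φ ⇒ □ a Ψ)
    mono⟨⟩ : ∀ {a} {φ ψ : Form (ag a)} → ⊢ (φ ⇒ ψ) → ⊢ (⟨ a ⟩ φ ⇒ ⟨ a ⟩ ψ)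
    mono[] : ∀ {a} {φ ψ : Form (ag a)} → ⊢ (φ ⇒ ψ) → ⊢ ([ a ] φ ⇒ [ a ] ψ)
    adj₁→  : ∀ {a} {Φ : Form wo} {ψ : Form (ag a)} → ⊢ (Φ ⇒ [ a ] ψ) → ⊢ (◇ a Φ ⇒ ψ)
    adj₁←  : ∀ {a} {Φ : Form wo} {ψ : Form (ag a)} → ⊢ (◇ a Φ ⇒ ψ) → ⊢ (Φ ⇒ [ a ] ψ)
    adj₂→  : ∀ {a} {φ : Form (ag a)} {Ψ : Form wo} → ⊢ (φ ⇒ □ a Ψ) → ⊢ (⟨ a ⟩ φ ⇒ Ψ)
    adj₂←  : ∀ {a} {φ : Form (ag a)} {Ψ : Form wo} → ⊢ (⟨ a ⟩ φ ⇒ Ψ) → ⊢ (φ ⇒ □ a Ψ)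
    unit   : ∀ {a} (φ : Form (ag a)) → ⊢ (φ ⇒ ◇ a (⟨ a ⟩ φ))
    counit : ∀ {a} (φ : Form (ag a)) → ⊢ (◇ a (⟨ a ⟩ φ) ⇒ φ)
    serial : ⊢ ⋁ (map (λ a → ⟨ a ⟩ ⊤') (allFin n))

  data _⊢'_ {s : Sort} (Γ : Pred (Form s) 0ℓ) : Form s → Set where
    hyp : ∀ {φ} → φ ∈ Γ → Γ ⊢' φ
    thm : ∀ {φ} → ⊢ φ → Γ ⊢' φ
    mp' : ∀ {φ ψ} → Γ ⊢' φ → Γ ⊢' (φ ⇒ ψ) → Γ ⊢' ψ

  Inconsistent : ∀ {s} → Pred (Form s) 0ℓ → Set
  Inconsistent Γ = Γ ⊢' ⊥'

  Consistent : ∀ {s} → Pred (Form s) 0ℓ → Set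
  Consistent Γ = ¬ Inconsistent Γ

  MCS : ∀ {s} → Pred (Form s) 0ℓ → Set₁
  MCS {s} Γ = Consistent Γ ×
              (∀ (Δ : Pred (Form s) 0ℓ) → Γ ⊆ Δ → Consistent Δ → Δ ⊆ Γ)

  CanWorld : Set₁
  CanWorld = Σ (Pred (Form wo) 0ℓ) MCS

  CanAgent : Agent → Set₁
  CanAgent a = Σ (Pred (Form (ag a)) 0ℓ) MCS

  R : (a : Agent) → CanWorld → CanAgent a → Set
  R a (SE , _) (Sa , _) = ∀ (Φ : Form wo) → Φ ∈ SE → ◇ a Φ ∈ Sa

{-# OPTIONS --safe #-}
-- Maximality makes S_E decide every world formula: were Φ not in S_E, then
-- ¬Φ would be, R_a would put ◇_a ¬Φ into S_a, and this clashes with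
-- □_a Φ = ¬◇_a ¬Φ ∈ S_a. Constructively this is run as: S_E ∪ {Φ} is
-- consistent, since refuting Φ from S_E would place ¬Φ in S_E. Only
-- propositional reasoning (a Hilbert-style deduction theorem) is needed.
module Submission where

open import Defs
open import Data.Nat using (ℕ; zero; suc)
open import Data.Bool using (true; false)
open import Data.Fin using (Fin)
open import Data.Sum using (inj₁; inj₂)
open import Data.Product using (proj₁; _,_)
open import Relation.Nullary using (¬_)
open import Relation.Unary using (Pred; _∈_; _∪_; ｛_｝)
open import Relation.Binary.PropositionalEquality using (refl)
open import Level using (0ℓ)

infixr 4 _⇒ᵖ_
_⇒ᵖ_ : PForm → PForm → PForm
t ⇒ᵖ u = p¬ (p∧ t (p¬ u))

x y z : PForm
x = pvar 0
y = pvar 1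
z = pvar 2

⇒-reflᵖ : PForm
⇒-reflᵖ = x ⇒ᵖ x

⇒-refl-taut : Tautology ⇒-reflᵖ
⇒-refl-taut v with v 0
... | true  = refl
... | false = refl

weakenᵖ : PForm
weakenᵖ = x ⇒ᵖ y ⇒ᵖ x

weaken-taut : Tautology weakenᵖ
weaken-taut v with v 0 | v 1
... | true  | true  = refl
... | true  | false = refl
... | false | _     = refl

distribᵖ : PForm
distribᵖ = (x ⇒ᵖ y) ⇒ᵖ (x ⇒ᵖ y ⇒ᵖ z) ⇒ᵖ x ⇒ᵖ z

distrib-taut : Tautology distribᵖ
distrib-taut v with v 0 | v 1 | v 2
... | true  | true  | true  = refl
... | true  | true  | false = refl
... | true  | false | _     = refl
... | false | true  | true  = refl
... | false | true  | false = refl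
... | false | false | true  = refl
... | false | false | false = refl

¬-introᵖ : PForm
¬-introᵖ = (x ⇒ᵖ p⊥) ⇒ᵖ p¬ x

¬-intro-taut : Tautology ¬-introᵖ
¬-intro-taut v with v 0
... | true  = refl
... | false = refl

¬-elimᵖ : PForm
¬-elimᵖ = p¬ x ⇒ᵖ x ⇒ᵖ p⊥

¬-elim-taut : Tautology ¬-elimᵖ
¬-elim-taut v with v 0
... | true  = refl
... | false = refl

module _ {n : ℕ} {APa : Fin n → Set} {APe : Set} where
  open TwoCH n APa APe

  private
    variable
      s : Sort
      Γ Δ : Pred (Form s) 0ℓ
      φ ψ : Form s

  ⟦_,_,_⟧ : Form s → Form s → Form s → ℕ → Form s
  ⟦ φ , ψ , χ ⟧ zero          = φ
  ⟦ φ , ψ , χ ⟧ (suc zero)    = ψ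
  ⟦ φ , ψ , χ ⟧ (suc (suc _)) = χ

  ⊢-weaken : ∀ (φ ψ : Form s) → ⊢ (φ ⇒ ψ ⇒ φ)
  ⊢-weaken φ ψ = taut weakenᵖ weaken-taut ⟦ φ , ψ , φ ⟧

  deduction : (Γ ∪ ｛ φ ｝) ⊢' ψ → Γ ⊢' (φ ⇒ ψ)
  deduction {φ = φ} {ψ} (hyp (inj₁ ψ∈Γ)) = mp' (hyp ψ∈Γ) (thm (⊢-weaken ψ φ))
  deduction {φ = φ} (hyp (inj₂ refl))    = thm (taut ⇒-reflᵖ ⇒-refl-taut ⟦ φ , φ , φ ⟧)
  deduction {φ = φ} {ψ} (thm ⊢ψ)         = mp' (thm ⊢ψ) (thm (⊢-weaken ψ φ))
  deduction {φ = φ} {ψ} (mp' {χ} d e)    =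
    mp' (deduction e) (mp' (deduction d) (thm (taut distribᵖ distrib-taut ⟦ φ , χ , ψ ⟧)))

  ⊢'-cut : (∀ {χ} → χ ∈ Δ → Γ ⊢' χ) → Δ ⊢' φ → Γ ⊢' φ
  ⊢'-cut Γ⊢Δ (hyp χ∈Δ)  = Γ⊢Δ χ∈Δ
  ⊢'-cut Γ⊢Δ (thm ⊢φ)   = thm ⊢φ
  ⊢'-cut Γ⊢Δ (mp' d e)  = mp' (⊢'-cut Γ⊢Δ d) (⊢'-cut Γ⊢Δ e)

  ¬'-intro : (Γ ∪ ｛ φ ｝) ⊢' ⊥' → Γ ⊢' ¬' φ
  ¬'-intro {φ = φ} d = mp' (deduction d) (thm (taut ¬-introᵖ ¬-intro-taut ⟦ φ , ⊥' , ⊥' ⟧))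

  ¬'-clash : φ ∈ Γ → ¬' φ ∈ Γ → Inconsistent Γ
  ¬'-clash {φ = φ} φ∈Γ ¬φ∈Γ =
    mp' (hyp φ∈Γ) (mp' (hyp ¬φ∈Γ) (thm (taut ¬-elimᵖ ¬-elim-taut ⟦ φ , ⊥' , ⊥' ⟧)))

  MCS-∈-if-∪-consistent : MCS Γ → Consistent (Γ ∪ ｛ φ ｝) → φ ∈ Γ
  MCS-∈-if-∪-consistent (_ , maximal) con = maximal _ inj₁ con (inj₂ refl)

  MCS-deductively-closed : MCS Γ → Γ ⊢' φ → φ ∈ Γ
  MCS-deductively-closed {Γ = Γ} {φ} Γ-mcs@(con , _) Γ⊢φ =
    MCS-∈-if-∪-consistent Γ-mcs (λ d → con (⊢'-cut Γ⊢Γ∪φ d))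
    where
    Γ⊢Γ∪φ : ∀ {χ} → χ ∈ (Γ ∪ ｛ φ ｝) → Γ ⊢' χ
    Γ⊢Γ∪φ (inj₁ χ∈Γ) = hyp χ∈Γ
    Γ⊢Γ∪φ (inj₂ refl) = Γ⊢φ

  MCS-∈-if-¬'∉ : MCS Γ → ¬ (¬' φ ∈ Γ) → φ ∈ Γ
  MCS-∈-if-¬'∉ Γ-mcs ¬φ∉Γ =
    MCS-∈-if-∪-consistent Γ-mcs λ d → ¬φ∉Γ (MCS-deductively-closed Γ-mcs (¬'-intro d))

mainTheorem8 : (n : ℕ) (APa : Fin n → Set) (APe : Set) →
    let open TwoCH n APa APe in
    (a : Agent) (SE : CanWorld) (Sa : CanAgent a) →
    R a SE Sa → (Φ : Form wo) → □ a Φ ∈ proj₁ Sa → Φ ∈ proj₁ SE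
mainTheorem8 n APa APe a (SE , SE-mcs) (Sa , Sa-con , _) SE-R-Sa Φ □Φ∈Sa =
  MCS-∈-if-¬'∉ SE-mcs λ ¬Φ∈SE → Sa-con (¬'-clash (SE-R-Sa (¬' Φ) ¬Φ∈SE) □Φ∈Sa)
  where open TwoCH n APa APe using (¬')
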